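{- The construction of cycles from rooted-signed-binary trees is injective on equivalence classes: if rooted-signed-binary trees $T$ and $T'$ produce the same cycle under the insertion construction, then $T$ and $T'$ are related by a sequence of allowed tree rotations.
   Context: A rooted-signed-binary tree is a finite rooted binary tree (each node has at most one left and at most one right child) in which every non-root node has a sign $+$ or $-$; the root is unsigned. Rotations: if $c$ is the left child of $v$, a right rotation at $v$ puts $c$ in $v$'s place, makes $v$ the right child of $c$, and makes the former right subtree of $c$ the left subtree of $v$; the left rotation is its inverse. A rotation is allowed if either $v$ is not the root and $v$ and the child $c$ rotating into its place have the same sign, or $v$ is the root, in which case $c$ becomes the new unsigned root and $v$ gets the sign $c$ had. A tree with $m$ nodes has $m+1$ empty child slots, ordered left to right in symmetric (in-order) order. A non-root leaf $v$ of $T$ is in relative position $i$ if it occupies the $i$-th empty slot of $T-\{v\}$ ($T$ with $v$ deleted). Construction: let $\xi_m(k)=k$ for $k<m$ and $\xi_m(k)=k+1$ for $k\ge m$. For a permutation $s_1\cdots s_n$ and $1\le i\le n$, positive insertion at $i$ gives $\xi_{i+1}(s_1)\cdots \xi_{i+1}(s_{i-1})\,(i{+}1)\,\xi_{i+1}(s_{i})\cdots \xi_{i+1}(s_{n})$, negative insertion at $i$ gives $\xi_{i}(s_1)\cdots \xi_{i}(s_{i})\,(i)\,\xi_{i}(s_{i+1})\cdots \xi_{i}(s_{n})$. Starting with $21$ for the root alone, process the non-root nodes in an order where each node follows its non-root parent; when $v$ is processed, with relative position $i$ in the tree formed by the root, the nodes processed so far and $v$, apply the positive or negative insertion at $i$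 according to the sign of $v$. The resulting permutation is the cycle produced by $T$. -}

module Defs where

open import Data.Nat using (ℕ; zero; suc; _+_; _∸_; _<ᵇ_; _<?_)
open import Data.Bool using (if_then_else_)
open import Data.List using (List; []; _∷_; _++_; map; take; drop; filter; length; foldl)
open import Data.Product using (_×_; _,_; proj₂)
open import Relation.Binary.Construct.Closure.Equivalence using (EqClosure)

data Sign : Set where
  plus minus : Sign

data SBT : Set where
  leaf : SBT
  node : Sign → SBT → SBT → SBT

record RSBT : Set where
  constructor root
  field
    left  : SBT
    right : SBT

size : SBT → ℕ
size leaf = 0
size (node _ l r) = suc (size l + size r)

data RotS : SBT → SBT → Set where
  rot   : ∀ s a b r → RotS (node s (node s a b) r) (node s a (node s b r))
  left  : ∀ s {l l′} r → RotS l l′ → RotS (node s l r) (node s l′ r)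
  right : ∀ s l {r r′} → RotS r r′ → RotS (node s l r) (node s l r′)

-- Allowed right rotations of a rooted-signed-binary tree.  At the root: the left
-- child c (sign s) becomes the new unsigned root and the old root gets sign s.
data Rot : RSBT → RSBT → Set where
  rotRoot : ∀ s a b R → Rot (root (node s a b) R) (root a (node s b R))
  inLeft  : ∀ {L L′} R → RotS L L′ → Rot (root L R) (root L′ R)
  inRight : ∀ L {R R′} → RotS R R′ → Rot (root L R) (root L R′)

-- Related by a sequence of allowed rotations (left rotations are the inverses of
-- right rotations, with the same allowedness condition): equivalence closure.
_≈rot_ : RSBT → RSBT → Set
_≈rot_ = EqClosure Rot

-- Insertions on permutations in one-line notation (lists of ℕ, values 1..n)

ξ : ℕ → ℕ → ℕ
ξ m k = if k <ᵇ m then k else suc k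

insPos : ℕ → List ℕ → List ℕ
insPos i s = take (i ∸ 1) s′ ++ suc i ∷ drop (i ∸ 1) s′
  where s′ = map (ξ (suc i)) s

insNeg : ℕ → List ℕ → List ℕ
insNeg i s = take i s′ ++ i ∷ drop i s′
  where s′ = map (ξ i) s

insertion : Sign → ℕ → List ℕ → List ℕ
insertion plus  = insPos
insertion minus = insNeg

-- Non-root nodes are processed in preorder (node, left subtree, right subtree),
-- in which each node follows its non-root parent.  Each node is recorded as
-- (its in-order index in T (0-based, counting the root), its sign).

preorder : ℕ → SBT → List (ℕ × Sign)
preorder o leaf = []
preorder o (node s l r) =
  (o + size l , s) ∷ preorder o l ++ preorder (suc (o + size l)) r

-- Relative position of the node with in-order index x, when the nodes with
-- in-order indices 'seen' (root and previously processed nodes) are present: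
-- 1 + number of present nodes preceding it in symmetric order.
relPos : List ℕ → ℕ → ℕ
relPos seen x = suc (length (filter (_<? x) seen))

step : List ℕ × List ℕ → ℕ × Sign → List ℕ × List ℕ
step (seen , p) (x , s) = (x ∷ seen , insertion s (relPos seen x) p)

cycleOf : RSBT → List ℕ
cycleOf (root L R) =
  proj₂ (foldl step (size L ∷ [] , 2 ∷ 1 ∷ [])
                    (preorder 0 L ++ preorder (suc (size L)) R))

-- Number the empty slots of a signed tree t from j in symmetric order, and let
-- word j t list them in the order they occur along a cycle: a leaf is its single
-- slot, and a node of sign + (resp. -) lists the slots of its left subtree before
-- (resp. after) those of its right subtree.  Inserting a node into slot i
-- subdivides the arrow leaving i, and every later insertion refines the
-- permutation the same way; so the cycle of T = root L R, read from 1, is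
-- word 1 (node + L R).  Root rotations bring T to the form root leaf R′ while
-- shifting this word cyclically, so the cycle determines word 2 R′.  Non-root
-- rotations preserve words, and they bring every tree to a normal form in which
-- no node has a left child of its own sign.  A normal tree is recovered from its
-- word: the word of the left subtree of a + node is the shortest nonempty prefix
-- made of the lowest slots, and that of a - node the shortest nonempty suffix
-- made of the lowest slots.

module Submission where

open import Defs
open import Data.Nat using (ℕ; zero; suc; _+_; _∸_; _<ᵇ_; _<?_; _≤_; _<_; s≤s; z<s; _≟_)
open import Data.Nat.Properties
open import Data.Bool using (true; false)
open import Data.List using (List; []; _∷_; _++_; map; take; drop; length; filter; foldl; concat)
open import Data.List.Properties using (length-map; length-++; ++-assoc; ++-identityʳ; map-++; concat-++; foldl-++; filter-++; filter-all; filter-accept; filter-reject; length-filter;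
         ∷-injective; ∷-injectiveʳ; ++-conicalʳ; ++-cancelˡ; ++-cancelʳ)
open import Data.List.NonEmpty as List⁺ using (List⁺; _∷_; head; tail; toList; _⁺++⁺_; concatMap)
open import Data.List.NonEmpty.Properties using (length-⁺++⁺; length-⁺++⁺-comm; ⁺++⁺-assoc)
open import Data.List.Relation.Unary.All as All using (All; []; _∷_)
open import Data.List.Relation.Unary.All.Properties using (++⁺; ++⁻ˡ; ++⁻ʳ)
open import Data.List.Relation.Unary.Any using (here)
open import Data.List.Membership.Propositional using (_∈_)
open import Data.List.Membership.Propositional.Properties using (∈-++⁺ˡ; ∈-++⁺ʳ)
open import Data.Product using (Σ; _×_; _,_; proj₁; proj₂)
open import Data.Sum as Sum using (_⊎_; inj₁; inj₂)
open import Function using (_∘_)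
open import Relation.Nullary using (Dec; yes; no; ofʸ; ofⁿ; contradiction)
open import Relation.Binary.Definitions using (Tri; tri<; tri≈; tri>)
open import Relation.Binary.PropositionalEquality
  using (_≡_; _≢_; _≗_; refl; sym; trans; cong; cong₂; subst; module ≡-Reasoning)
open import Relation.Binary.Construct.Closure.Equivalence using (EqClosure; gmap; symmetric)
open import Relation.Binary.Construct.Closure.ReflexiveTransitive using (ε; _◅_; _◅◅_)
open import Relation.Binary.Construct.Closure.Symmetric using (fwd; bwd)
open import Data.Nat.Tactic.RingSolver using (solve-∀)

nth : ℕ → List ℕ → ℕ
nth _       []       = 0
nth zero    (x ∷ _)  = x
nth (suc k) (_ ∷ xs) = nth k xs

-- The image of x under the permutation with one-line notation p; 0 is a junk
-- value, in particular the image of 0.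
apply : List ℕ → ℕ → ℕ
apply p zero    = 0
apply p (suc k) = nth k p

nth-map : ∀ {f : ℕ → ℕ} → f 0 ≡ 0 → ∀ k q → nth k (map f q) ≡ f (nth k q)
nth-map f0≡0 k       []      = sym f0≡0
nth-map f0≡0 zero    (x ∷ q) = refl
nth-map f0≡0 (suc k) (x ∷ q) = nth-map f0≡0 k q

insertAt : ℕ → ℕ → List ℕ → List ℕ
insertAt k v q = take k q ++ v ∷ drop k q

module _ (v : ℕ) where

  length-insertAt : ∀ k q → length (insertAt k v q) ≡ suc (length q)
  length-insertAt zero    q       = refl
  length-insertAt (suc k) []      = refl
  length-insertAt (suc k) (x ∷ q) = cong suc (length-insertAt k q)

  nth-insertAt-< : ∀ k q m → k ≤ length q → m < k → nth m (insertAt k v q) ≡ nth m q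
  nth-insertAt-< (suc k) (x ∷ q) zero    _         _         = refl
  nth-insertAt-< (suc k) (x ∷ q) (suc m) (s≤s k≤∣q∣) (s≤s m<k) = nth-insertAt-< k q m k≤∣q∣ m<k

  nth-insertAt-≡ : ∀ k q → k ≤ length q → nth k (insertAt k v q) ≡ v
  nth-insertAt-≡ zero    q       _           = refl
  nth-insertAt-≡ (suc k) (x ∷ q) (s≤s k≤∣q∣) = nth-insertAt-≡ k q k≤∣q∣

  nth-insertAt-> : ∀ k q m → k ≤ length q → k ≤ m → nth (suc m) (insertAt k v q) ≡ nth m q
  nth-insertAt-> zero    q       m       _           _         = refl
  nth-insertAt-> (suc k) (x ∷ q) (suc m) (s≤s k≤∣q∣) (s≤s k≤m) = nth-insertAt-> k q m k≤∣q∣ k≤m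

ξ-< : ∀ {m k} → k < m → ξ m k ≡ k
ξ-< {m} {k} k<m with k <ᵇ m | <ᵇ-reflects-< k m
... | true  | _        = refl
... | false | ofⁿ k≮m = contradiction k<m k≮m

ξ-≥ : ∀ {m k} → m ≤ k → ξ m k ≡ suc k
ξ-≥ {m} {k} m≤k with k <ᵇ m | <ᵇ-reflects-< k m
... | true  | ofʸ k<m = contradiction m≤k (<⇒≱ k<m)
... | false | _        = refl

ξ-≢ : ∀ c y → y ≢ suc c → ξ (suc (suc c)) y ≡ ξ (suc c) y
ξ-≢ c y y≢1+c with <-cmp y (suc c)
... | tri< y<1+c _ _ = trans (ξ-< (m<n⇒m<1+n y<1+c)) (sym (ξ-< y<1+c))
... | tri≈ _ y≡1+c _ = contradiction y≡1+c y≢1+c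
... | tri> _ _ 1+c<y = trans (ξ-≥ 1+c<y) (sym (ξ-≥ (<⇒≤ 1+c<y)))

apply-insertAt : ∀ {f : ℕ → ℕ} → f 0 ≡ 0 → ∀ k v q → k ≤ length q →
                 ∀ y → apply (insertAt k v (map f q)) (ξ (suc k) y) ≡ f (apply q y)
apply-insertAt f0≡0 k v q k≤∣q∣ zero = sym f0≡0
apply-insertAt {f} f0≡0 k v q k≤∣q∣ (suc m)
  with <-cmp m k | subst (k ≤_) (sym (length-map f q)) k≤∣q∣
... | tri< m<k _ _ | k≤∣fq∣ rewrite ξ-< (s≤s m<k) =
  trans (nth-insertAt-< v k (map f q) m k≤∣fq∣ m<k) (nth-map f0≡0 m q)
... | tri≈ _ refl _ | k≤∣fq∣ rewrite ξ-≥ (≤-refl {suc m}) =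
  trans (nth-insertAt-> v k (map f q) m k≤∣fq∣ ≤-refl) (nth-map f0≡0 m q)
... | tri> _ _ k<m | k≤∣fq∣ rewrite ξ-≥ (s≤s (<⇒≤ k<m)) =
  trans (nth-insertAt-> v k (map f q) m k≤∣fq∣ (<⇒≤ k<m)) (nth-map f0≡0 m q)

Walk : List ℕ → ℕ → List ℕ → ℕ → Set
Walk p x []       z = apply p x ≡ z
Walk p x (y ∷ ys) z = apply p x ≡ y × Walk p y ys z

Path : List ℕ → List⁺ ℕ → ℕ → Set
Path p w z = Walk p (head w) (tail w) z

Cycle : List ℕ → List⁺ ℕ → Set
Cycle p w = Path p w (head w)

Refines : List ℕ → List ℕ → (ℕ → List⁺ ℕ) → Set
Refines p p′ f = ∀ x → Path p′ (f x) (head (f (apply p x)))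

walk-++ : ∀ {p x y z} us {vs} → Walk p x us y → Walk p y vs z → Walk p x (us ++ y ∷ vs) z
walk-++ []       x↦y           y⇝z = x↦y , y⇝z
walk-++ (u ∷ us) (x↦u , u⇝y) y⇝z = x↦u , walk-++ us u⇝y y⇝z

walk-++⁻ : ∀ {p x y z} us {vs} → Walk p x (us ++ y ∷ vs) z → Walk p x us y × Walk p y vs z
walk-++⁻ []       (x↦y , y⇝z) = x↦y , y⇝z
walk-++⁻ (u ∷ us) (x↦u , u⇝z) with walk-++⁻ us u⇝z
... | u⇝y , y⇝z = (x↦u , u⇝y) , y⇝z

walk-unique : ∀ {p x y z} ys zs → Walk p x ys y → Walk p x zs z → length ys ≡ length zs → ys ≡ zs
walk-unique []       []       _               _               _   = refl
walk-unique (y ∷ ys) (z ∷ zs) (refl , y⇝) (refl , z⇝) ∣ys∣≡∣zs∣ =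
  cong (y ∷_) (walk-unique ys zs y⇝ z⇝ (suc-injective ∣ys∣≡∣zs∣))

walk-refine : ∀ {p p′ f} → Refines p p′ f → ∀ x ys {z} →
              Walk p x ys z → Path p′ (concatMap f (x ∷ ys)) (head (f z))
walk-refine {f = f} ref x []       refl rewrite ++-identityʳ (tail (f x)) = ref x
walk-refine {f = f} ref x (y ∷ ys) (refl , y⇝z) = walk-++ (tail (f x)) (ref x) (walk-refine ref y ys y⇝z)

refines-∘ : ∀ {p p′ p″ f g} → Refines p p′ f → Refines p′ p″ g → Refines p p″ (concatMap g ∘ f)
refines-∘ {f = f} ref-f ref-g x = walk-refine ref-g (head (f x)) (tail (f x)) (ref-f x)

refines-cong : ∀ {p p′ f g} → f ≗ g → Refines p p′ f → Refines p p′ g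
refines-cong {p} {p′} {f} {g} f≗g ref x =
  subst (λ w → Path p′ w (head (g (apply p x)))) (f≗g x)
    (subst (λ w → Path p′ (f x) (head w)) (f≗g (apply p x)) (ref x))

cycle-refine : ∀ {p p′ f} → Refines p p′ f → ∀ w → Cycle p w → Cycle p′ (concatMap f w)
cycle-refine ref w = walk-refine ref (head w) (tail w)

cycle-rotate : ∀ {p} u v → Cycle p (u ⁺++⁺ v) → Cycle p (v ⁺++⁺ u)
cycle-rotate u v c with walk-++⁻ (tail u) c
... | u⇝v , v⇝u = walk-++ (tail v) v⇝u u⇝v

-- concatMap g (x ∷ xs) unfolds to g x ⁺++ concatMapᴸ g xs.
concatMapᴸ : (ℕ → List⁺ ℕ) → List ℕ → List ℕ
concatMapᴸ g xs = concat (map toList (map g xs))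

concatMapᴸ-++ : ∀ g xs ys → concatMapᴸ g (xs ++ ys) ≡ concatMapᴸ g xs ++ concatMapᴸ g ys
concatMapᴸ-++ g xs ys = begin
  concat (map toList (map g (xs ++ ys)))                  ≡⟨ cong (concat ∘ map toList) (map-++ g xs ys) ⟩
  concat (map toList (map g xs ++ map g ys))              ≡⟨ cong concat (map-++ toList (map g xs) (map g ys)) ⟩
  concat (map toList (map g xs) ++ map toList (map g ys)) ≡⟨ sym (concat-++ (map toList (map g xs)) _) ⟩
  concatMapᴸ g xs ++ concatMapᴸ g ys                      ∎
  where open ≡-Reasoning

concatMap-⁺++⁺ : ∀ g u v → concatMap g (u ⁺++⁺ v) ≡ concatMap g u ⁺++⁺ concatMap g v
concatMap-⁺++⁺ g (x ∷ xs) (y ∷ ys) = cong (head (g x) ∷_) (begin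
  tail (g x) ++ concatMapᴸ g (xs ++ y ∷ ys)
    ≡⟨ cong (tail (g x) ++_) (concatMapᴸ-++ g xs (y ∷ ys)) ⟩
  tail (g x) ++ (concatMapᴸ g xs ++ concatMapᴸ g (y ∷ ys))
    ≡⟨ sym (++-assoc (tail (g x)) _ _) ⟩
  (tail (g x) ++ concatMapᴸ g xs) ++ concatMapᴸ g (y ∷ ys) ∎)
  where open ≡-Reasoning

concatMap-singleton : ∀ (g : ℕ → List⁺ ℕ) x → concatMap g (x ∷ []) ≡ g x
concatMap-singleton g x = cong (head (g x) ∷_) (++-identityʳ (tail (g x)))

concatMapᴸ-fixed : ∀ {g} {xs} → All (λ x → g x ≡ x ∷ []) xs → concatMapᴸ g xs ≡ xs
concatMapᴸ-fixed []                 = refl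
concatMapᴸ-fixed (g[x]≡[x] ∷ fixed) rewrite g[x]≡[x] = cong (_ ∷_) (concatMapᴸ-fixed fixed)

concatMap-fixed : ∀ {g} w → All (λ x → g x ≡ x ∷ []) (toList w) → concatMap g w ≡ w
concatMap-fixed (x ∷ xs) (g[x]≡[x] ∷ fixed) rewrite g[x]≡[x] = cong (x ∷_) (concatMapᴸ-fixed fixed)

glue : Sign → List⁺ ℕ → List⁺ ℕ → List⁺ ℕ
glue plus  u v = u ⁺++⁺ v
glue minus u v = v ⁺++⁺ u

concatMap-glue : ∀ g s u v → concatMap g (glue s u v) ≡ glue s (concatMap g u) (concatMap g v)
concatMap-glue g plus  u v = concatMap-⁺++⁺ g u v
concatMap-glue g minus u v = concatMap-⁺++⁺ g v u

word : ℕ → SBT → List⁺ ℕ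
word j leaf         = j ∷ []
word j (node s l r) = glue s (word j l) (word (suc (j + size l)) r)

-- Fill slot j with the tree t, renumbering the later slots.
expand : SBT → ℕ → ℕ → List⁺ ℕ
expand t j x with <-cmp x j
... | tri< _ _ _ = x ∷ []
... | tri≈ _ _ _ = word j t
... | tri> _ _ _ = x + size t ∷ []

expand-< : ∀ t {j x} → x < j → expand t j x ≡ x ∷ []
expand-< t {j} {x} x<j with <-cmp x j
... | tri< _ _ _    = refl
... | tri≈ x≮j _ _ = contradiction x<j x≮j
... | tri> x≮j _ _ = contradiction x<j x≮j

expand-≡ : ∀ t j → expand t j j ≡ word j t
expand-≡ t j with <-cmp j j
... | tri< j<j _ _ = contradiction j<j (n≮n j)
... | tri≈ _ _ _    = refl
... | tri> _ _ j<j = contradiction j<j (n≮n j)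

expand-> : ∀ t {j x} → j < x → expand t j x ≡ x + size t ∷ []
expand-> t {j} {x} j<x with <-cmp x j
... | tri< _ _ x≯j = contradiction j<x x≯j
... | tri≈ _ _ x≯j = contradiction j<x x≯j
... | tri> _ _ _    = refl

suc-+-assoc : ∀ j a b → suc (j + a) + b ≡ j + suc (a + b)
suc-+-assoc j a b = trans (cong suc (+-assoc j a b)) (sym (+-suc j (a + b)))

InRange : ℕ → ℕ → ℕ → Set
InRange lo hi a = lo ≤ a × a < hi

InRange-weaken : ∀ {lo hi lo′ hi′} → lo′ ≤ lo → hi ≤ hi′ → ∀ {a} → InRange lo hi a → InRange lo′ hi′ a
InRange-weaken lo′≤lo hi≤hi′ (lo≤a , a<hi) = ≤-trans lo′≤lo lo≤a , <-≤-trans a<hi hi≤hi′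

word-range : ∀ j t → All (InRange j (suc (j + size t))) (toList (word j t))
word-range j leaf = (≤-refl , s≤s (m≤m+n j 0)) ∷ []
word-range j (node s l r) =
  glue-All s (All.map (InRange-weaken ≤-refl (s≤s (+-monoʳ-≤ j (m≤n⇒m≤1+n (m≤m+n (size l) (size r))))))
                      (word-range j l))
             (All.map (InRange-weaken (m≤n⇒m≤1+n (m≤m+n j (size l))) (≤-reflexive (cong suc (suc-+-assoc j (size l) (size r)))))
                      (word-range (suc (j + size l)) r))
  where
  glue-All : ∀ {P} s {u v} → All P (toList u) → All P (toList v) → All P (toList (glue s u v))
  glue-All plus  Pu Pv = ++⁺ Pu Pv
  glue-All minus Pu Pv = ++⁺ Pv Pu

word-below : ∀ j t → All (_< suc (j + size t)) (toList (word j t))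
word-below j t = All.map proj₂ (word-range j t)

concatMap-expand-below : ∀ t {j} w → All (_< j) (toList w) → concatMap (expand t j) w ≡ w
concatMap-expand-below t w below = concatMap-fixed w (All.map (expand-< t) below)

word-node : ∀ s l r j →
  concatMap (expand r (suc (j + size l))) (concatMap (expand l j) (word j (node s leaf leaf)))
    ≡ word j (node s l r)
word-node s l r j = begin
  concatMap Er (concatMap El (glue s (j ∷ []) (suc (j + 0) ∷ [])))
    ≡⟨ cong (concatMap Er) (concatMap-glue El s _ _) ⟩
  concatMap Er (glue s (concatMap El (j ∷ [])) (concatMap El (suc (j + 0) ∷ [])))
    ≡⟨ cong (concatMap Er) (cong₂ (glue s) (trans (concatMap-singleton El j) (expand-≡ l j))
                                          (trans (concatMap-singleton El (suc (j + 0))) El-next)) ⟩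
  concatMap Er (glue s (word j l) (j′ ∷ []))
    ≡⟨ concatMap-glue Er s _ _ ⟩
  glue s (concatMap Er (word j l)) (concatMap Er (j′ ∷ []))
    ≡⟨ cong₂ (glue s) (concatMap-expand-below r (word j l) (word-below j l))
                      (trans (concatMap-singleton Er j′) (expand-≡ r j′)) ⟩
  glue s (word j l) (word j′ r) ∎
  where
  open ≡-Reasoning
  j′ = suc (j + size l)
  El = expand l j
  Er = expand r j′
  El-next : El (suc (j + 0)) ≡ j′ ∷ []
  El-next = trans (expand-> l (s≤s (m≤m+n j 0))) (cong (λ n → suc n + size l ∷ []) (+-identityʳ j))

expand-node : ∀ s l r j x →
  concatMap (expand r (suc (j + size l))) (concatMap (expand l j) (expand (node s leaf leaf) j x))
    ≡ expand (node s l r) j x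
expand-node s l r j x = by-cases (<-cmp x j)
  -- A helper instead of with: abstracting <-cmp x j would also hide it inside expand.
  where
  open ≡-Reasoning
  j′ = suc (j + size l)
  Er = expand r j′
  +-one-assoc : ∀ x a b → x + 1 + a + b ≡ x + suc (a + b)
  +-one-assoc = solve-∀
  by-cases : Tri (x < j) (x ≡ j) (j < x) →
             concatMap Er (concatMap (expand l j) (expand (node s leaf leaf) j x)) ≡ expand (node s l r) j x
  by-cases (tri< x<j _ _) rewrite expand-< (node s leaf leaf) x<j | expand-< (node s l r) x<j =
    trans (cong (concatMap Er) (trans (concatMap-singleton (expand l j) x) (expand-< l x<j)))
          (trans (concatMap-singleton Er x) (expand-< r (m<n⇒m<1+n (<-≤-trans x<j (m≤m+n j (size l))))))
  by-cases (tri≈ _ refl _) rewrite expand-≡ (node s leaf leaf) j | expand-≡ (node s l r) j = word-node s l r j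
  by-cases (tri> _ _ j<x) rewrite expand-> (node s leaf leaf) j<x | expand-> (node s l r) j<x = begin
    concatMap Er (concatMap (expand l j) (x + 1 ∷ []))
      ≡⟨ cong (concatMap Er) (trans (concatMap-singleton (expand l j) (x + 1)) (expand-> l (<-≤-trans j<x (m≤m+n x 1)))) ⟩
    concatMap Er (x + 1 + size l ∷ [])
      ≡⟨ trans (concatMap-singleton Er (x + 1 + size l)) (expand-> r (+-monoˡ-< (size l) (≤-<-trans j<x (m<m+n x z<s)))) ⟩
    x + 1 + size l + size r ∷ []
      ≡⟨ cong (_∷ []) (+-one-assoc x (size l) (size r)) ⟩
    x + size (node s l r) ∷ [] ∎

-- insertion s (suc c) p relabels the values of p by relabel s c and moves the
-- entry at position y to position s c y.
relabel : Sign → ℕ → ℕ → ℕ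
relabel plus  c = ξ (suc (suc c))
relabel minus c = ξ (suc c)

position : Sign → ℕ → ℕ → ℕ
position plus  c = ξ (suc c)
position minus c = ξ (suc (suc c))

relabel-< : ∀ s {c y} → y < suc c → relabel s c y ≡ y
relabel-< plus  y<1+c = ξ-< (m<n⇒m<1+n y<1+c)
relabel-< minus y<1+c = ξ-< y<1+c

relabel-> : ∀ s {c y} → suc c < y → relabel s c y ≡ suc y
relabel-> plus  1+c<y = ξ-≥ 1+c<y
relabel-> minus 1+c<y = ξ-≥ (<⇒≤ 1+c<y)

position-≢ : ∀ s c y → y ≢ suc c → position s c y ≡ relabel s c y
position-≢ plus  c y y≢1+c = sym (ξ-≢ c y y≢1+c)
position-≢ minus c y y≢1+c = ξ-≢ c y y≢1+c

apply-insertion : ∀ s c p → suc c ≤ length p →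
                  ∀ y → apply (insertion s (suc c) p) (position s c y) ≡ relabel s c (apply p y)
apply-insertion plus  c p 1+c≤∣p∣ = apply-insertAt refl c (suc (suc c)) p (≤-trans (n≤1+n c) 1+c≤∣p∣)
apply-insertion minus c p 1+c≤∣p∣ = apply-insertAt refl (suc c) (suc c) p 1+c≤∣p∣

apply-insertion-new : ∀ s c p → suc c ≤ length p →
                      apply (insertion s (suc c) p) (relabel s c (suc c)) ≡ position s c (suc c)
apply-insertion-new plus c p 1+c≤∣p∣
  rewrite ξ-< (n<1+n (suc c)) | ξ-≥ (≤-refl {suc c}) =
  nth-insertAt-≡ (suc (suc c)) c (map (ξ (suc (suc c))) p)
    (≤-trans (n≤1+n c) (subst (suc c ≤_) (sym (length-map _ p)) 1+c≤∣p∣))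
apply-insertion-new minus c p 1+c≤∣p∣
  rewrite ξ-≥ (≤-refl {suc c}) | ξ-< (n<1+n (suc c)) =
  nth-insertAt-≡ (suc c) (suc c) (map (ξ (suc c)) p) (subst (suc c ≤_) (sym (length-map _ p)) 1+c≤∣p∣)

expand-unit-≢ : ∀ s c {x} → x ≢ suc c → expand (node s leaf leaf) (suc c) x ≡ relabel s c x ∷ []
expand-unit-≢ s c {x} x≢1+c = by-cases (<-cmp x (suc c))
  where
  by-cases : Tri (x < suc c) (x ≡ suc c) (suc c < x) → expand (node s leaf leaf) (suc c) x ≡ relabel s c x ∷ []
  by-cases (tri< x<1+c _ _) =
    trans (expand-< (node s leaf leaf) x<1+c) (cong (_∷ []) (sym (relabel-< s x<1+c)))
  by-cases (tri≈ _ x≡1+c _) = contradiction x≡1+c x≢1+c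
  by-cases (tri> _ _ 1+c<x) =
    trans (expand-> (node s leaf leaf) 1+c<x) (cong (_∷ []) (trans (+-comm x 1) (sym (relabel-> s 1+c<x))))

expand-unit-≡ : ∀ s c → expand (node s leaf leaf) (suc c) (suc c) ≡ relabel s c (suc c) ∷ position s c (suc c) ∷ []
expand-unit-≡ plus c
  rewrite expand-≡ (node plus leaf leaf) (suc c) | ξ-< (n<1+n (suc c)) | ξ-≥ (≤-refl {suc c}) | +-identityʳ c = refl
expand-unit-≡ minus c
  rewrite expand-≡ (node minus leaf leaf) (suc c) | ξ-≥ (≤-refl {suc c}) | ξ-< (n<1+n (suc c)) | +-identityʳ c = refl

head-expand-unit : ∀ s c y → head (expand (node s leaf leaf) (suc c) y) ≡ relabel s c y
head-expand-unit s c y = by-cases (y ≟ suc c)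
  where
  by-cases : Dec (y ≡ suc c) → head (expand (node s leaf leaf) (suc c) y) ≡ relabel s c y
  by-cases (yes refl)     = cong head (expand-unit-≡ s c)
  by-cases (no y≢1+c) = cong head (expand-unit-≢ s c y≢1+c)

insertion-refines : ∀ s c p → suc c ≤ length p →
                    Refines p (insertion s (suc c) p) (expand (node s leaf leaf) (suc c))
insertion-refines s c p 1+c≤∣p∣ x = by-cases (x ≟ suc c)
  where
  p′ = insertion s (suc c) p
  U = expand (node s leaf leaf) (suc c)
  by-cases : Dec (x ≡ suc c) → Path p′ (U x) (head (U (apply p x)))
  by-cases (yes refl) rewrite expand-unit-≡ s c | head-expand-unit s c (apply p (suc c)) =
    apply-insertion-new s c p 1+c≤∣p∣ , apply-insertion s c p 1+c≤∣p∣ (suc c)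
  by-cases (no x≢1+c) rewrite expand-unit-≢ s c x≢1+c | head-expand-unit s c (apply p x) =
    trans (cong (apply p′) (sym (position-≢ s c x x≢1+c))) (apply-insertion s c p 1+c≤∣p∣ x)

count : ℕ → List ℕ → ℕ
count y xs = length (filter (_<? y) xs)

count-++ : ∀ y xs ys → count y (xs ++ ys) ≡ count y xs + count y ys
count-++ y xs ys = trans (cong length (filter-++ (_<? y) xs ys)) (length-++ (filter (_<? y) xs))

count-all : ∀ {y xs} → All (_< y) xs → count y xs ≡ length xs
count-all {y} all = cong length (filter-all (_<? y) all)

count-≤ : ∀ y xs → count y xs ≤ length xs
count-≤ y = length-filter (_<? y)

count-∷-< : ∀ {y x} xs → x < y → count y (x ∷ xs) ≡ suc (count y xs)
count-∷-< {y} xs x<y = cong length (filter-accept (_<? y) {xs = xs} x<y)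

count-∷-≥ : ∀ {y x} xs → y ≤ x → count y (x ∷ xs) ≡ count y xs
count-∷-≥ {y} xs y≤x = cong length (filter-reject (_<? y) {xs = xs} (≤⇒≯ y≤x))

Outside : ℕ → ℕ → ℕ → Set
Outside lo hi a = a < lo ⊎ hi ≤ a

count-outside : ∀ {lo hi y xs} → All (Outside lo hi) xs → lo ≤ y → y ≤ hi → count y xs ≡ count lo xs
count-outside []                         lo≤y y≤hi = refl
count-outside {xs = _ ∷ xs} (inj₁ a<lo ∷ out) lo≤y y≤hi =
  trans (count-∷-< xs (<-≤-trans a<lo lo≤y))
        (trans (cong suc (count-outside out lo≤y y≤hi)) (sym (count-∷-< xs a<lo)))
count-outside {xs = _ ∷ xs} (inj₂ hi≤a ∷ out) lo≤y y≤hi =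
  trans (count-∷-≥ xs (≤-trans y≤hi hi≤a))
        (trans (count-outside out lo≤y y≤hi) (sym (count-∷-≥ xs (≤-trans lo≤y (≤-trans y≤hi hi≤a)))))

length-insertion : ∀ s i p → length (insertion s i p) ≡ suc (length p)
length-insertion plus  i p = trans (length-insertAt (suc i) (i ∸ 1) (map (ξ (suc i)) p)) (cong suc (length-map _ p))
length-insertion minus i p = trans (length-insertAt i i (map (ξ i) p)) (cong suc (length-map _ p))

Balanced : List ℕ × List ℕ → Set
Balanced (seen , p) = length p ≡ suc (length seen)

foldl-step-balanced : ∀ st xs → Balanced st → Balanced (foldl step st xs)
foldl-step-balanced st                []            balanced = balanced
foldl-step-balanced (seen , p) ((x , s) ∷ xs) balanced =
  foldl-step-balanced _ xs (trans (length-insertion s _ p) (cong suc balanced))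

expand-leaf : ∀ j x → expand leaf j x ≡ x ∷ []
expand-leaf j x with <-cmp x j
... | tri< _ _ _    = refl
... | tri≈ _ refl _ = refl
... | tri> _ _ _    = cong (_∷ []) (+-identityʳ x)

module _ (o a b : ℕ) {seen : List ℕ} (outside : All (Outside o (o + suc (a + b))) seen)
         (A : List ℕ) (A-inside : All (InRange o (o + a)) A) where

  private
    A-below : All (_< suc (o + a)) A
    A-below = All.map (λ a∈ → m<n⇒m<1+n (proj₂ a∈)) A-inside

  outside-past-block : All (Outside (suc (o + a)) (suc (o + a) + b)) (A ++ o + a ∷ seen)
  outside-past-block =
    ++⁺ (All.map inj₁ A-below)
        (inj₁ ≤-refl ∷ All.map (Sum.map (λ x<o → <-≤-trans x<o (m≤n⇒m≤1+n (m≤m+n o a)))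
                                        (≤-trans (≤-reflexive (suc-+-assoc o a b))))
                                outside)

  count-past-block : length A ≡ a → count (suc (o + a)) (A ++ o + a ∷ seen) ≡ suc (count o seen) + a
  count-past-block ∣A∣≡a = begin
    count (suc (o + a)) (A ++ o + a ∷ seen)                    ≡⟨ count-++ (suc (o + a)) A (o + a ∷ seen) ⟩
    count (suc (o + a)) A + count (suc (o + a)) (o + a ∷ seen) ≡⟨ cong₂ _+_ (trans (count-all A-below) ∣A∣≡a)
                                                                            (count-∷-< seen (n<1+n (o + a))) ⟩
    a + suc (count (suc (o + a)) seen)                         ≡⟨ cong (λ n → a + suc n) (count-outside outside o≤1+o+a 1+o+a≤) ⟩
    a + suc (count o seen)                                     ≡⟨ +-comm a (suc (count o seen)) ⟩
    suc (count o seen) + a                                     ∎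
    where
    open ≡-Reasoning
    o≤1+o+a = m≤n⇒m≤1+n (m≤m+n o a)
    1+o+a≤ = +-monoʳ-< o (s≤s (m≤m+n a b))

length-blocks : ∀ (B A : List ℕ) x {a b} → length A ≡ a → length B ≡ b → length (B ++ A ++ x ∷ []) ≡ suc (a + b)
length-blocks B A x {a} {b} ∣A∣≡a ∣B∣≡b rewrite length-++ B {A ++ x ∷ []} | length-++ A {x ∷ []} | ∣A∣≡a | ∣B∣≡b =
  +-one-comm a b
  where
  +-one-comm : ∀ a b → b + (a + 1) ≡ suc (a + b)
  +-one-comm = solve-∀

-- The subtree t, with in-order indices o, …, o + size t - 1, is grafted into slot
-- suc (count o seen) of the tree formed by the nodes seen before it.
record Processed (t : SBT) (o : ℕ) (seen p : List ℕ) (final : List ℕ × List ℕ) : Set where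
  field
    added        : List ℕ
    seen-grows   : proj₁ final ≡ added ++ seen
    length-added : length added ≡ size t
    added-inside : All (InRange o (o + size t)) added
    refines      : Refines p (proj₂ final) (expand t (suc (count o seen)))

process : ∀ t o seen p → All (Outside o (o + size t)) seen → Balanced (seen , p) →
          Processed t o seen p (foldl step (seen , p) (preorder o t))
process leaf o seen p _ _ = record
  { added        = []
  ; seen-grows   = refl
  ; length-added = refl
  ; added-inside = []
  ; refines      = refines-cong (λ x → sym (expand-leaf _ x)) (λ x → refl)
  }
process (node s l r) o seen p outside balanced =
  subst (Processed (node s l r) o seen p)
        (sym (foldl-++ step (x ∷ seen , p₁) (preorder o l) (preorder (suc x) r)))
        (record
          { added        = R.added ++ L.added ++ x ∷ []
          ; seen-grows   = seen-grows
          ; length-added = length-blocks R.added L.added x L.length-added R.length-added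
          ; added-inside = ++⁺ (All.map (InRange-weaken o≤1+x (≤-reflexive (suc-+-assoc o (size l) (size r))))
                                        R.added-inside)
                               (++⁺ (All.map (InRange-weaken ≤-refl (<⇒≤ x<hi)) L.added-inside)
                                    ((m≤m+n o (size l) , x<hi) ∷ []))
          ; refines      = refines-cong (expand-node s l r (suc c)) (refines-∘ (refines-∘ insert refinesₗ) refinesᵣ)
          })
  where
  open ≡-Reasoning
  x  = o + size l
  hi = o + size (node s l r)
  c  = count o seen
  x<hi : x < hi
  x<hi = +-monoʳ-< o (s≤s (m≤m+n (size l) (size r)))
  o≤1+x : o ≤ suc x
  o≤1+x = m≤n⇒m≤1+n (m≤m+n o (size l))

  count-x : count x seen ≡ c
  count-x = count-outside outside (m≤m+n o (size l)) (<⇒≤ x<hi)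
  p₁ = insertion s (suc (count x seen)) p
  insert : Refines p p₁ (expand (node s leaf leaf) (suc c))
  insert = subst (λ n → Refines p p₁ (expand (node s leaf leaf) (suc n))) count-x
             (insertion-refines s (count x seen) p (subst (suc (count x seen) ≤_) (sym balanced) (s≤s (count-≤ x seen))))
  balanced₁ : Balanced (x ∷ seen , p₁)
  balanced₁ = trans (length-insertion s _ p) (cong suc balanced)

  outsideₗ : All (Outside o (o + size l)) (x ∷ seen)
  outsideₗ = inj₂ ≤-refl ∷ All.map (Sum.map₂ (≤-trans (<⇒≤ x<hi))) outside
  module L = Processed (process l o (x ∷ seen) p₁ outsideₗ balanced₁)
  stateₗ = foldl step (x ∷ seen , p₁) (preorder o l)
  refinesₗ : Refines p₁ (proj₂ stateₗ) (expand l (suc c))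
  refinesₗ = subst (λ n → Refines p₁ (proj₂ stateₗ) (expand l (suc n))) (count-∷-≥ seen (m≤m+n o (size l))) L.refines

  outsideᵣ : All (Outside (suc x) (suc x + size r)) (proj₁ stateₗ)
  outsideᵣ = subst (All _) (sym L.seen-grows) (outside-past-block o (size l) (size r) outside L.added L.added-inside)
  count-1+x : count (suc x) (proj₁ stateₗ) ≡ suc c + size l
  count-1+x = trans (cong (count (suc x)) L.seen-grows)
                    (count-past-block o (size l) (size r) outside L.added L.added-inside L.length-added)
  module R = Processed (process r (suc x) (proj₁ stateₗ) (proj₂ stateₗ) outsideᵣ
                                (foldl-step-balanced _ (preorder o l) balanced₁))
  final = foldl step stateₗ (preorder (suc x) r)
  refinesᵣ : Refines (proj₂ stateₗ) (proj₂ final) (expand r (suc (suc c + size l)))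
  refinesᵣ = subst (λ n → Refines (proj₂ stateₗ) (proj₂ final) (expand r (suc n))) count-1+x R.refines

  seen-grows : proj₁ final ≡ (R.added ++ L.added ++ x ∷ []) ++ seen
  seen-grows = begin
    proj₁ final                            ≡⟨ R.seen-grows ⟩
    R.added ++ proj₁ stateₗ                ≡⟨ cong (R.added ++_) L.seen-grows ⟩
    R.added ++ L.added ++ x ∷ seen         ≡⟨ cong (R.added ++_) (sym (++-assoc L.added (x ∷ []) seen)) ⟩
    R.added ++ (L.added ++ x ∷ []) ++ seen ≡⟨ sym (++-assoc R.added _ seen) ⟩
    (R.added ++ L.added ++ x ∷ []) ++ seen ∎

-- cycleOf (root L R) is the outcome of this run: the root acts as a positive node
-- inserted into the one-element permutation 1.
cycleOf-processed : ∀ L R → Processed (node plus L R) 0 [] (1 ∷ []) (foldl step ([] , 1 ∷ []) (preorder 0 (node plus L R)))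
cycleOf-processed L R = process (node plus L R) 0 [] (1 ∷ []) [] refl

cycleOf-cycle : ∀ L R → Cycle (cycleOf (root L R)) (word 1 (node plus L R))
cycleOf-cycle L R =
  subst (Cycle (cycleOf (root L R))) (trans (concatMap-singleton (expand t 1) 1) (expand-≡ t 1))
        (cycle-refine (Processed.refines (cycleOf-processed L R)) (1 ∷ []) refl)
  where t = node plus L R

length-cycleOf : ∀ L R → length (cycleOf (root L R)) ≡ suc (size (node plus L R))
length-cycleOf L R = begin
  length (cycleOf (root L R))   ≡⟨ foldl-step-balanced ([] , 1 ∷ []) (preorder 0 t) refl ⟩
  suc (length (proj₁ final))    ≡⟨ cong (suc ∘ length) P.seen-grows ⟩
  suc (length (P.added ++ []))  ≡⟨ cong (suc ∘ length) (++-identityʳ P.added) ⟩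
  suc (length P.added)          ≡⟨ cong suc P.length-added ⟩
  suc (size t)                  ∎
  where
  open ≡-Reasoning
  t = node plus L R
  final = foldl step ([] , 1 ∷ []) (preorder 0 t)
  module P = Processed (cycleOf-processed L R)

_≈S_ : SBT → SBT → Set
_≈S_ = EqClosure RotS

length-glue : ∀ s u v → List⁺.length (glue s u v) ≡ List⁺.length u + List⁺.length v
length-glue plus  u v = length-⁺++⁺ u v
length-glue minus u v = trans (length-⁺++⁺-comm v u) (length-⁺++⁺ u v)

length-word : ∀ j t → List⁺.length (word j t) ≡ suc (size t)
length-word j leaf         = refl
length-word j (node s l r) = begin
  List⁺.length (glue s (word j l) (word _ r))                        ≡⟨ length-glue s (word j l) _ ⟩
  List⁺.length (word j l) + List⁺.length (word (suc (j + size l)) r) ≡⟨ cong₂ _+_ (length-word j l) (length-word _ r) ⟩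
  suc (size l) + suc (size r)                                        ≡⟨ cong suc (+-suc (size l) (size r)) ⟩
  suc (size (node s l r))                                            ∎
  where open ≡-Reasoning

size-≡ : ∀ {j t t′} → word j t ≡ word j t′ → size t ≡ size t′
size-≡ {j} {t} {t′} same =
  suc-injective (trans (sym (length-word j t)) (trans (cong List⁺.length same) (length-word j t′)))

glue-assoc : ∀ s u v w → glue s (glue s u v) w ≡ glue s u (glue s v w)
glue-assoc plus  u v w = ⁺++⁺-assoc u v w
glue-assoc minus u v w = sym (⁺++⁺-assoc w v u)

rotS-word : ∀ {t t′} → RotS t t′ → ∀ j → word j t ≡ word j t′
rotS-word (rot s a b r) j = begin
  glue s (glue s (word j a) (word (suc (j + size a)) b)) (word (suc (j + suc (size a + size b))) r)
    ≡⟨ cong (λ k → glue s (glue s (word j a) (word (suc (j + size a)) b)) (word (suc k) r))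
            (sym (suc-+-assoc j (size a) (size b))) ⟩
  glue s (glue s (word j a) (word (suc (j + size a)) b)) (word (suc (suc (j + size a) + size b)) r)
    ≡⟨ glue-assoc s (word j a) _ _ ⟩
  glue s (word j a) (glue s (word (suc (j + size a)) b) (word (suc (suc (j + size a) + size b)) r)) ∎
  where open ≡-Reasoning
rotS-word (left s r l→l′) j =
  cong₂ (λ w n → glue s w (word (suc (j + n)) r)) (rotS-word l→l′ j) (size-≡ (rotS-word l→l′ j))
rotS-word (right s l r→r′) j = cong (glue s (word j l)) (rotS-word r→r′ (suc (j + size l)))

≈S-word : ∀ {t t′} → t ≈S t′ → ∀ j → word j t ≡ word j t′
≈S-word ε                 j = refl
≈S-word (fwd t→t′ ◅ rots) j = trans (rotS-word t→t′ j) (≈S-word rots j)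
≈S-word (bwd t′→t ◅ rots) j = trans (sym (rotS-word t′→t j)) (≈S-word rots j)

rootRot-cycle : ∀ s a b R {p} → Cycle p (word 1 (node plus (node s a b) R)) → Cycle p (word 1 (node plus a (node s b R)))
rootRot-cycle s a b R {p} cycle =
  subst (λ k → Cycle p (word 1 a ⁺++⁺ glue s wb (word (suc k) R))) (sym (suc-+-assoc 1 (size a) (size b)))
        (reassociate s cycle)
  where
  wb = word (suc (1 + size a)) b
  reassociate : ∀ s {u v w} → Cycle p (glue s u v ⁺++⁺ w) → Cycle p (u ⁺++⁺ glue s v w)
  reassociate plus  {u} {v} {w} c = subst (Cycle p) (⁺++⁺-assoc u v w) c
  reassociate minus {u} {v} {w} c =
    subst (Cycle p) (⁺++⁺-assoc u w v) (cycle-rotate v (u ⁺++⁺ w) (subst (Cycle p) (⁺++⁺-assoc v u w) c))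

record Flattening (L R : SBT) : Set where
  field
    flattened : SBT
    rotations : root L R ≈rot root leaf flattened
    same-size : size (node plus L R) ≡ size (node plus leaf flattened)
    cycle     : ∀ {p} → Cycle p (word 1 (node plus L R)) → Cycle p (word 1 (node plus leaf flattened))

flatten : ∀ L R → Flattening L R
flatten leaf R = record { flattened = R ; rotations = ε ; same-size = refl ; cycle = λ c → c }
flatten (node s a b) R = record
  { flattened = F.flattened
  ; rotations = fwd (rotRoot s a b R) ◅ F.rotations
  ; same-size = trans (cong suc (suc-+-assoc (size a) (size b) (size R))) F.same-size
  ; cycle     = F.cycle ∘ rootRot-cycle s a b R
  }
  where module F = Flattening (flatten a (node s b R))

opposite : Sign → Sign
opposite plus  = minus
opposite minus = plus

data RootSign (s : Sign) : SBT → Set where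
  leaf : RootSign s leaf
  node : ∀ {l r} → RootSign s (node s l r)

-- Exactly the trees to which no right rotation applies.
data Normal : SBT → Set where
  leaf : Normal leaf
  node : ∀ {s l r} → RootSign (opposite s) l → Normal l → Normal r → Normal (node s l r)

normalNode : Sign → SBT → SBT → SBT
normalNode s     leaf             r = node s leaf r
normalNode plus  (node plus  a b) r = node plus a (normalNode plus b r)
normalNode plus  (node minus a b) r = node plus (node minus a b) r
normalNode minus (node minus a b) r = node minus a (normalNode minus b r)
normalNode minus (node plus  a b) r = node minus (node plus a b) r

normalNode-normal : ∀ s {l r} → Normal l → Normal r → Normal (normalNode s l r)
normalNode-normal s     leaf                        nr = node leaf leaf nr
normalNode-normal plus  (node {plus}  ha na nb) nr = node ha na (normalNode-normal plus nb nr)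
normalNode-normal plus  (node {minus} ha na nb) nr = node node (node ha na nb) nr
normalNode-normal minus (node {minus} ha na nb) nr = node ha na (normalNode-normal minus nb nr)
normalNode-normal minus (node {plus}  ha na nb) nr = node node (node ha na nb) nr

≈S-congˡ : ∀ s {l l′} r → l ≈S l′ → node s l r ≈S node s l′ r
≈S-congˡ s r = gmap (λ l → node s l r) (left s r)

≈S-congʳ : ∀ s l {r r′} → r ≈S r′ → node s l r ≈S node s l r′
≈S-congʳ s l = gmap (node s l) (right s l)

normalNode-≈S : ∀ s l r → node s l r ≈S normalNode s l r
normalNode-≈S s     leaf             r = ε
normalNode-≈S plus  (node plus  a b) r = fwd (rot plus a b r) ◅ ≈S-congʳ plus a (normalNode-≈S plus b r)
normalNode-≈S plus  (node minus a b) r = ε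
normalNode-≈S minus (node minus a b) r = fwd (rot minus a b r) ◅ ≈S-congʳ minus a (normalNode-≈S minus b r)
normalNode-≈S minus (node plus  a b) r = ε

normalise : SBT → SBT
normalise leaf         = leaf
normalise (node s l r) = normalNode s (normalise l) (normalise r)

normalise-normal : ∀ t → Normal (normalise t)
normalise-normal leaf         = leaf
normalise-normal (node s l r) = normalNode-normal s (normalise-normal l) (normalise-normal r)

normalise-≈S : ∀ t → t ≈S normalise t
normalise-≈S leaf         = ε
normalise-≈S (node s l r) =
  ≈S-congˡ s r (normalise-≈S l) ◅◅ ≈S-congʳ s (normalise l) (normalise-≈S r) ◅◅ normalNode-≈S s _ _

++-split : ∀ {A : Set} (xs ys us vs : List A) → xs ++ ys ≡ us ++ vs →
           (Σ (List A) λ C → xs ≡ us ++ C × vs ≡ C ++ ys) ⊎ (Σ (List A) λ C → us ≡ xs ++ C × ys ≡ C ++ vs)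
++-split []       ys us       vs eq = inj₂ (us , refl , eq)
++-split (x ∷ xs) ys []       vs eq = inj₁ (x ∷ xs , refl , sym eq)
++-split (x ∷ xs) ys (u ∷ us) vs eq with ∷-injective eq
... | refl , eq′ with ++-split xs ys us vs eq′
...   | inj₁ (C , xs≡ , vs≡) = inj₁ (C , cong (x ∷_) xs≡ , vs≡)
...   | inj₂ (C , us≡ , ys≡) = inj₂ (C , cong (x ∷_) us≡ , ys≡)

wordᴸ : ℕ → SBT → List ℕ
wordᴸ j t = toList (word j t)

word-min : ∀ j t → j ∈ wordᴸ j t
word-min j leaf             = here refl
word-min j (node plus  l r) = ∈-++⁺ˡ (word-min j l)
word-min j (node minus l r) = ∈-++⁺ʳ (wordᴸ _ r) (word-min j l)

word-max : ∀ j t → j + size t ∈ wordᴸ j t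
word-max-right : ∀ j l r → j + suc (size l + size r) ∈ wordᴸ (suc (j + size l)) r

word-max j leaf             = here (+-identityʳ j)
word-max j (node plus  l r) = ∈-++⁺ʳ (wordᴸ j l) (word-max-right j l r)
word-max j (node minus l r) = ∈-++⁺ˡ (word-max-right j l r)

word-max-right j l r = subst (_∈ wordᴸ (suc (j + size l)) r) (suc-+-assoc j (size l) (size r)) (word-max _ r)

word-lower : ∀ j t → All (_< j + length (wordᴸ j t)) (wordᴸ j t)
word-lower j t = subst (λ n → All (_< n) (wordᴸ j t)) (sym (j+∣word∣ j t)) (word-below j t)
  where
  j+∣word∣ : ∀ j t → j + length (wordᴸ j t) ≡ suc (j + size t)
  j+∣word∣ j t = trans (cong (j +_) (length-word j t)) (+-suc j (size t))

word-upper : ∀ j l r → All (j + length (wordᴸ j l) ≤_) (wordᴸ (suc (j + size l)) r)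
word-upper j l r = All.map (λ a∈ → ≤-trans (≤-reflexive j+∣word∣) (proj₁ a∈)) (word-range _ r)
  where
  j+∣word∣ : j + length (wordᴸ j l) ≡ suc (j + size l)
  j+∣word∣ = trans (cong (j +_) (length-word j l)) (+-suc j (size l))

empty-if-≤ : ∀ j (A : List ℕ) → j + length A ≤ j → A ≡ []
empty-if-≤ j []      _     = refl
empty-if-≤ j (a ∷ A) j+n≤j = contradiction j+n≤j (m+1+n≰m j)

empty-if-long : ∀ j n (A B : List ℕ) → j + n < j + length A → length A + length B ≡ suc n → B ≡ []
empty-if-long j n A []      _   _ = refl
empty-if-long j n A (b ∷ B) n<A ∣AB∣≡ =
  contradiction (≤-trans (≤-reflexive ∣AB∣≡) (+-cancelˡ-< j n (length A) n<A)) (m+1+n≰m (length A))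

lower-prefix-trivial : ∀ j {t} → RootSign minus t → ∀ A B → A ++ B ≡ wordᴸ j t →
                       All (_< j + length A) A → All (j + length A ≤_) B → A ≡ [] ⊎ B ≡ []
lower-prefix-trivial j leaf []      B _  _ _ = inj₁ refl
lower-prefix-trivial j leaf (a ∷ A) B eq _ _ = inj₂ (++-conicalʳ A B (∷-injectiveʳ eq))
lower-prefix-trivial j {node minus l r} node A B eq A-low B-high
  with ++-split A B (wordᴸ (suc (j + size l)) r) (wordᴸ j l) eq
... | inj₁ (C , A≡ , _) = inj₂ (empty-if-long j (size (node minus l r)) A B max<j+∣A∣ ∣A∣+∣B∣≡)
  where
  max<j+∣A∣ : j + size (node minus l r) < j + length A
  max<j+∣A∣ = All.lookup A-low (subst (_ ∈_) (sym A≡) (∈-++⁺ˡ (word-max-right j l r)))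
  ∣A∣+∣B∣≡ : length A + length B ≡ suc (size (node minus l r))
  ∣A∣+∣B∣≡ = trans (sym (length-++ A)) (trans (cong length eq) (length-word j (node minus l r)))
... | inj₂ (C , _ , B≡) = inj₁ (empty-if-≤ j A (All.lookup B-high (subst (j ∈_) (sym B≡) (∈-++⁺ʳ C (word-min j l)))))

upper-prefix-trivial : ∀ j {t} → RootSign plus t → ∀ A B → A ++ B ≡ wordᴸ j t →
                       All (j + length B ≤_) A → All (_< j + length B) B → A ≡ [] ⊎ B ≡ []
upper-prefix-trivial j leaf []      B _  _ _ = inj₁ refl
upper-prefix-trivial j leaf (a ∷ A) B eq _ _ = inj₂ (++-conicalʳ A B (∷-injectiveʳ eq))
upper-prefix-trivial j {node plus l r} node A B eq A-high B-low
  with ++-split A B (wordᴸ j l) (wordᴸ (suc (j + size l)) r) eq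
... | inj₁ (C , A≡ , _) = inj₂ (empty-if-≤ j B (All.lookup A-high (subst (j ∈_) (sym A≡) (∈-++⁺ˡ (word-min j l)))))
... | inj₂ (C , _ , B≡) = inj₁ (empty-if-long j (size (node plus l r)) B A max<j+∣B∣ ∣B∣+∣A∣≡)
  where
  max<j+∣B∣ : j + size (node plus l r) < j + length B
  max<j+∣B∣ = All.lookup B-low (subst (_ ∈_) (sym B≡) (∈-++⁺ʳ C (word-max-right j l r)))
  ∣B∣+∣A∣≡ : length B + length A ≡ suc (size (node plus l r))
  ∣B∣+∣A∣≡ = trans (+-comm (length B) (length A))
               (trans (sym (length-++ A)) (trans (cong length eq) (length-word j (node plus l r))))

lower-block : ∀ j l l′ C → RootSign minus l → wordᴸ j l ≡ wordᴸ j l′ ++ C →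
              All (j + length (wordᴸ j l′) ≤_) C → wordᴸ j l ≡ wordᴸ j l′
lower-block j l l′ C hl l≡l′++C C-high
  with lower-prefix-trivial j hl (wordᴸ j l′) C (sym l≡l′++C) (word-lower j l′) C-high
... | inj₂ refl = trans l≡l′++C (++-identityʳ _)

upper-block : ∀ j l l′ C → RootSign plus l′ → wordᴸ j l′ ≡ C ++ wordᴸ j l →
              All (j + length (wordᴸ j l) ≤_) C → wordᴸ j l′ ≡ wordᴸ j l
upper-block j l l′ C hl′ l′≡C++l C-high
  with upper-prefix-trivial j hl′ C (wordᴸ j l) (sym l′≡C++l) C-high (word-lower j l)
... | inj₁ refl = l′≡C++l

plus-left-block : ∀ j {l r l′ r′} → RootSign minus l → RootSign minus l′ →
                  wordᴸ j (node plus l r) ≡ wordᴸ j (node plus l′ r′) → wordᴸ j l ≡ wordᴸ j l′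
plus-left-block j {l} {r} {l′} {r′} hl hl′ eq
  with ++-split (wordᴸ j l) (wordᴸ (suc (j + size l)) r) (wordᴸ j l′) (wordᴸ (suc (j + size l′)) r′) eq
... | inj₁ (C , l≡l′++C , r′≡C++r) =
  lower-block j l l′ C hl l≡l′++C (++⁻ˡ C (subst (All _) r′≡C++r (word-upper j l′ r′)))
... | inj₂ (C , l′≡l++C , r≡C++r′) =
  sym (lower-block j l′ l C hl′ l′≡l++C (++⁻ˡ C (subst (All _) r≡C++r′ (word-upper j l r))))

minus-left-block : ∀ j {l r l′ r′} → RootSign plus l → RootSign plus l′ →
                   wordᴸ j (node minus l r) ≡ wordᴸ j (node minus l′ r′) → wordᴸ j l ≡ wordᴸ j l′
minus-left-block j {l} {r} {l′} {r′} hl hl′ eq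
  with ++-split (wordᴸ (suc (j + size l)) r) (wordᴸ j l) (wordᴸ (suc (j + size l′)) r′) (wordᴸ j l′) eq
... | inj₁ (C , r≡r′++C , l′≡C++l) =
  sym (upper-block j l l′ C hl′ l′≡C++l (++⁻ʳ (wordᴸ _ r′) (subst (All _) r≡r′++C (word-upper j l r))))
... | inj₂ (C , r′≡r++C , l≡C++l′) =
  upper-block j l′ l C hl l≡C++l′ (++⁻ʳ (wordᴸ _ r) (subst (All _) r′≡r++C (word-upper j l′ r′)))

plus≢minus : ∀ j l r l′ r′ → wordᴸ j (node plus l r) ≢ wordᴸ j (node minus l′ r′)
plus≢minus j l r l′ r′ eq
  with lower-prefix-trivial j (node {l = l′} {r = r′}) (wordᴸ j l) (wordᴸ (suc (j + size l)) r) eq (word-lower j l) (word-upper j l r)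
... | inj₁ ()
... | inj₂ ()

leaf≢node : ∀ j {s l r} → wordᴸ j leaf ≢ wordᴸ j (node s l r)
leaf≢node j {s} {l} {r} eq with trans (cong length eq) (length-word j (node s l r))
... | ()

normal-word-injective : ∀ j {t t′} → Normal t → Normal t′ → wordᴸ j t ≡ wordᴸ j t′ → t ≡ t′
normal-word-injective j leaf leaf _ = refl
normal-word-injective j leaf (node {s} {l} {r} _ _ _) eq = contradiction eq (leaf≢node j {s} {l} {r})
normal-word-injective j (node {s} {l} {r} _ _ _) leaf eq = contradiction (sym eq) (leaf≢node j {s} {l} {r})
normal-word-injective j (node {plus} {l} {r} hl nl nr) (node {plus} {l′} {r′} hl′ nl′ nr′) eq
  with normal-word-injective j nl nl′ (plus-left-block j {l} {r} {l′} {r′} hl hl′ eq)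
... | refl = cong (node plus l) (normal-word-injective _ nr nr′ (++-cancelˡ (wordᴸ j l) _ _ eq))
normal-word-injective j (node {minus} {l} {r} hl nl nr) (node {minus} {l′} {r′} hl′ nl′ nr′) eq
  with normal-word-injective j nl nl′ (minus-left-block j {l} {r} {l′} {r′} hl hl′ eq)
... | refl = cong (node minus l) (normal-word-injective _ nr nr′ (++-cancelʳ (wordᴸ j l) _ _ eq))
normal-word-injective j (node {plus} {l} {r} _ _ _) (node {minus} {l′} {r′} _ _ _) eq =
  contradiction eq (plus≢minus j l r l′ r′)
normal-word-injective j (node {minus} {l} {r} _ _ _) (node {plus} {l′} {r′} _ _ _) eq =
  contradiction (sym eq) (plus≢minus j l′ r′ l r)

same-word-≈S : ∀ j {t t′} → wordᴸ j t ≡ wordᴸ j t′ → t ≈S t′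
same-word-≈S j {t} {t′} eq =
  subst (t ≈S_) (normal-word-injective j (normalise-normal t) (normalise-normal t′) normal-words) (normalise-≈S t)
    ◅◅ symmetric RotS (normalise-≈S t′)
  where
  normal-words : wordᴸ j (normalise t) ≡ wordᴸ j (normalise t′)
  normal-words = trans (cong toList (sym (≈S-word (normalise-≈S t) j))) (trans eq (cong toList (≈S-word (normalise-≈S t′) j)))

same-cycle-size : ∀ L R L′ R′ → cycleOf (root L R) ≡ cycleOf (root L′ R′) → size (node plus L R) ≡ size (node plus L′ R′)
same-cycle-size L R L′ R′ same =
  suc-injective (trans (sym (length-cycleOf L R)) (trans (cong length same) (length-cycleOf L′ R′)))

mainTheorem7 : (T T′ : RSBT) → cycleOf T ≡ cycleOf T′ → T ≈rot T′
mainTheorem7 (root L R) (root L′ R′) same =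
  F.rotations ◅◅ gmap (root leaf) (inRight leaf) flattened-≈S ◅◅ symmetric Rot F′.rotations
  where
  module F  = Flattening (flatten L R)
  module F′ = Flattening (flatten L′ R′)
  p = cycleOf (root L R)
  cycle : Cycle p (word 1 (node plus leaf F.flattened))
  cycle = F.cycle (cycleOf-cycle L R)
  cycle′ : Cycle p (word 1 (node plus leaf F′.flattened))
  cycle′ = F′.cycle (subst (λ q → Cycle q (word 1 (node plus L′ R′))) (sym same) (cycleOf-cycle L′ R′))
  same-length : length (wordᴸ 2 F.flattened) ≡ length (wordᴸ 2 F′.flattened)
  same-length = trans (length-word 2 F.flattened)
    (trans (trans (sym F.same-size) (trans (same-cycle-size L R L′ R′ same) F′.same-size)) (sym (length-word 2 F′.flattened)))
  flattened-≈S : F.flattened ≈S F′.flattened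
  flattened-≈S = same-word-≈S 2 (walk-unique (wordᴸ 2 F.flattened) (wordᴸ 2 F′.flattened) cycle cycle′ same-length)
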